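{- Let $G$ be a thin connected graph with prime factor decomposition $G=G_1\boxtimes\cdots\boxtimes G_n$ with respect to the strong product, and let $(x,y)$ be an edge of $G$ that is indispensable in $\langle N[x]\cup N[y]\rangle$. Then $(x,y)$ is Cartesian in $G$, and the edge-neighborhood $\langle N[x]\cup N[y]\rangle$ is a subproduct of $G$.
   Context: All graphs are finite, simple, connected, undirected. $N[v]$ is the closed neighborhood of $v$, and $\langle W\rangle$ is the induced subgraph on $W$. $G$ is thin if no two distinct vertices have equal closed neighborhoods. The strong product $\boxtimes_{i}G_i$ has vertex set $\times_i V(G_i)$; distinct vertices are adjacent iff in each coordinate they are equal or adjacent. An edge is Cartesian if its endpoints differ in exactly one coordinate; for thin graphs this is independent of the chosen coordinatization. A subproduct of $\boxtimes_i G_i$ is a subgraph of the form $\boxtimes_i H_i$ with $H_i$ a subgraph of $G_i$. Dispensability: an edge $(x,y)$ of a graph $K$ is dispensable in $K$ if there exists $z\in V(K)$ with both of the following, where neighborhoods are taken in $K$ and $\subset$ is proper inclusion: (1) $N[x]\cap N[y]\subset N[x]\cap N[z]$ or $N[x]\subset N[z]\subset N[y]$; (2) $N[x]\cap N[y]\subset N[y]\cap N[z]$ or $N[y]\subset N[z]\subset N[x]$. Otherwise it is indispensable in $K$. -}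

module Defs where

open import Data.Nat using (ℕ; _<_)
open import Data.Fin using (Fin)
open import Data.Product using (Σ; ∃; ∃-syntax; _×_; _,_; proj₁; proj₂)
open import Data.Sum using (_⊎_)
open import Relation.Nullary using (¬_; Dec)
open import Relation.Binary.PropositionalEquality using (_≡_)
open import Relation.Binary.Construct.Closure.ReflexiveTransitive using (Star)
open import Function.Bundles using (_↔_; _⇔_)

record Graph : Set₁ where
  field
    V      : Set
    size   : ℕ
    enum   : V ↔ Fin size
    Adj    : V → V → Set
    adj?   : ∀ u v → Dec (Adj u v)
    sym    : ∀ {u v} → Adj u v → Adj v u
    irrefl : ∀ {u} → ¬ Adj u u

open Graph public

N[_]∋_ : (G : Graph) → V G → V G → Set
N[ G ]∋ u = λ w → w ≡ u ⊎ Adj G u w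

Connected : Graph → Set
Connected G = ∀ u v → Star (Adj G) u v

Thin : Graph → Set
Thin G = ∀ u v → (∀ w → (N[ G ]∋ u) w ⇔ (N[ G ]∋ v) w) → u ≡ v

Nontrivial : Graph → Set
Nontrivial G = 1 < size G

Trivial : Graph → Set
Trivial G = size G ≡ 1

StrongAdj₂ : (A B : Graph) → V A × V B → V A × V B → Set
StrongAdj₂ A B (a , b) (a' , b') =
  ¬ (a ≡ a' × b ≡ b') × (a ≡ a' ⊎ Adj A a a') × (b ≡ b' ⊎ Adj B b b')

record IsoStrong₂ (H A B : Graph) : Set where
  field
    ψ    : V H → V A × V B
    inj  : ∀ u v → ψ u ≡ ψ v → u ≡ v
    surj : ∀ p → ∃[ u ] ψ u ≡ p
    adj  : ∀ u v → Adj H u v ⇔ StrongAdj₂ A B (ψ u) (ψ v)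

Prime : Graph → Set₁
Prime H = Nontrivial H × (∀ (A B : Graph) → IsoStrong₂ H A B → Trivial A ⊎ Trivial B)

-- vertices of the strong product ⊠_{i<k} F i are functions c : (i : Fin k) → V (F i);
-- equality of such tuples is taken coordinatewise (no funext needed)
StrongAdj : ∀ {k} (F : Fin k → Graph) → ((i : Fin k) → V (F i)) → ((i : Fin k) → V (F i)) → Set
StrongAdj F c d = ¬ (∀ i → c i ≡ d i) × (∀ i → c i ≡ d i ⊎ Adj (F i) (c i) (d i))

record IsoStrong (G : Graph) {k : ℕ} (F : Fin k → Graph) : Set where
  field
    φ    : V G → (i : Fin k) → V (F i)
    inj  : ∀ u v → (∀ i → φ u i ≡ φ v i) → u ≡ v
    surj : ∀ (c : (i : Fin k) → V (F i)) → ∃[ u ] (∀ i → φ u i ≡ c i)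
    adj  : ∀ u v → Adj G u v ⇔ StrongAdj F (φ u) (φ v)

record PFD (G : Graph) : Set₁ where
  field
    k      : ℕ
    F      : Fin k → Graph
    prime  : ∀ i → Prime (F i)
    iso    : IsoStrong G F

EN : (G : Graph) → V G → V G → V G → Set
EN G x y w = (N[ G ]∋ x) w ⊎ (N[ G ]∋ y) w

-- closed neighbourhood of a inside the induced subgraph K = ⟨W⟩
NK : (G : Graph) → (V G → Set) → V G → V G → Set
NK G W a w = W w × (N[ G ]∋ a) w

_⊆_ : {A : Set} → (A → Set) → (A → Set) → Set
P ⊆ Q = ∀ w → P w → Q w

_⊂_ : {A : Set} → (A → Set) → (A → Set) → Set
P ⊂ Q = P ⊆ Q × ∃[ w ] (Q w × ¬ P w)

_∩_ : {A : Set} → (A → Set) → (A → Set) → A → Set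
(P ∩ Q) w = P w × Q w

Dispensable : (G : Graph) → (V G → Set) → V G → V G → Set
Dispensable G W x y =
  ∃[ z ] (W z ×
    ((Nx ∩ Ny) ⊂ (Nx ∩ NK G W z) ⊎ (Nx ⊂ NK G W z × NK G W z ⊂ Ny)) ×
    ((Nx ∩ Ny) ⊂ (Ny ∩ NK G W z) ⊎ (Ny ⊂ NK G W z × NK G W z ⊂ Nx)))
  where
    Nx = NK G W x
    Ny = NK G W y

Indispensable : (G : Graph) → (V G → Set) → V G → V G → Set
Indispensable G W x y = ¬ Dispensable G W x y

Cartesian : ∀ {G : Graph} {k} {F : Fin k → Graph} → IsoStrong G F → V G → V G → Set
Cartesian {k = k} ι u v =
  ∃[ i ] (¬ φ u i ≡ φ v i × (∀ (j : Fin k) → ¬ j ≡ i → φ u j ≡ φ v j))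
  where open IsoStrong ι

record Subgraph (A : Graph) : Set₁ where
  field
    U      : V A → Set
    E      : V A → V A → Set
    E⊆Adj  : ∀ {a b} → E a b → Adj A a b
    E⊆U    : ∀ {a b} → E a b → U a × U b
    Esym   : ∀ {a b} → E a b → E b a

-- the induced subgraph ⟨W⟩ of G is (under φ) the subproduct ⊠_i H i
IsSubproduct : ∀ {G : Graph} {k} {F : Fin k → Graph} → IsoStrong G F → (V G → Set) → Set₁
IsSubproduct {G} {k} {F} ι W =
  Σ ((i : Fin k) → Subgraph (F i)) λ H →
    (∀ w → W w ⇔ (∀ i → Subgraph.U (H i) (φ w i))) ×
    (∀ u v → W u → W v →
      Adj G u v ⇔ (¬ (∀ i → φ u i ≡ φ v i) ×
                   (∀ i → φ u i ≡ φ v i ⊎ Subgraph.E (H i) (φ u i) (φ v i))))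
  where open IsoStrong ι

-- In a coordinatization G ≅ ⊠ F k every closed neighbourhood is a box,
-- N[u] = ∏ N[u_k].  With 𝒜 k = N[x_k], ℬ k = N[y_k] and z i the vertex x with
-- its i-th coordinate replaced by y_i, we get N[z i] = ℬ i × ∏_{k≠i} 𝒜 k.
-- Thinness of G turns x_k ≠ y_k into 𝒜 k ≠ ℬ k.  If x and y differed in two
-- coordinates i ≠ j, then, according to which of 𝒜 k ⊈ ℬ k and ℬ k ⊈ 𝒜 k hold,
-- some z i would make (x,y) dispensable in ⟨N[x] ∪ N[y]⟩, the strict inclusions
-- being witnessed by vertices that differ from x in one coordinate.  So (x,y) is
-- Cartesian, and then N[x] ∪ N[y] is the box ∏ (𝒜 k ∪ ℬ k), i.e. a subproduct.
module Submission where

open import Defs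
open import Data.Product using (∃-syntax; _×_; _,_; proj₁; proj₂)
open import Data.Sum using (inj₁; inj₂; [_,_]; map₂)
open import Data.Nat using (ℕ)
open import Data.Fin using (Fin) renaming (_≟_ to _≟ᶠ_)
open import Data.Fin.Properties using (all?; ¬∀⟶∃¬)
open import Function using (id)
open import Function.Bundles using (_⇔_; mk⇔; Equivalence)
open import Function.Properties.Inverse using (↔⇒↣)
open import Function.Construct.Composition using (_⇔-∘_)
open import Level using (Level)
open import Relation.Binary.Definitions using (DecidableEquality)
open import Relation.Binary.PropositionalEquality as ≡ using (_≡_; _≢_; refl; subst)
open import Relation.Nullary
  using (¬_; yes; no; contradiction; ¬¬-excluded-middle; decidable-stable)
open import Relation.Nullary.Decidable using (via-injection)
open import Relation.Unary using (Decidable; _∪_)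

open Equivalence using (to; from)

vertex-≟ : (H : Graph) → DecidableEquality (V H)
vertex-≟ H = via-injection (↔⇒↣ (enum H)) _≟ᶠ_

N-dec : (H : Graph) (u : V H) → Decidable (N[ H ]∋ u)
N-dec H u w with vertex-≟ H w u | adj? H u w
... | yes w≡u | _      = yes (inj₁ w≡u)
... | no _    | yes uw = yes (inj₂ uw)
... | no w≢u  | no ¬uw = no [ w≢u , ¬uw ]

N-sym : (H : Graph) {u w : V H} → (N[ H ]∋ u) w → (N[ H ]∋ w) u
N-sym H (inj₁ refl) = inj₁ refl
N-sym H (inj₂ uw)   = inj₂ (Graph.sym H uw)

_⊈_ : {A : Set} → (A → Set) → (A → Set) → Set
P ⊈ Q = ∃[ w ] (P w × ¬ Q w)

⊆-from-¬⊈ : {A : Set} {P Q : A → Set} → Decidable Q → ¬ P ⊈ Q → P ⊆ Q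
⊆-from-¬⊈ Q? ¬P⊈Q w Pw with Q? w
... | yes Qw = Qw
... | no ¬Qw = contradiction (w , Pw , ¬Qw) ¬P⊈Q

⊈-weaken : {A : Set} {P P′ Q Q′ : A → Set} → P ⊈ Q → P ⊆ P′ → Q′ ⊆ Q → P′ ⊈ Q′
⊈-weaken (w , Pw , ¬Qw) P⊆P′ Q′⊆Q = w , P⊆P′ w Pw , λ Q′w → ¬Qw (Q′⊆Q w Q′w)

module _ {n : ℕ} where

  ∀-at-and-elsewhere : ∀ {p} {P : Fin n → Set p} (i : Fin n) →
                       P i → (∀ k → k ≢ i → P k) → ∀ k → P k
  ∀-at-and-elsewhere i Pi Pk k with k ≟ᶠ i
  ... | yes refl = Pi
  ... | no k≢i   = Pk k k≢i

  module _ {a : Level} {X : Fin n → Set a} where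

    _[_]≔_ : ((k : Fin n) → X k) → (i : Fin n) → X i → (k : Fin n) → X k
    (c [ i ]≔ b) k with k ≟ᶠ i
    ... | yes refl = b
    ... | no _     = c k

    update-at : (c : (k : Fin n) → X k) (i : Fin n) (b : X i) →
                (c [ i ]≔ b) i ≡ b
    update-at c i b with i ≟ᶠ i
    ... | yes refl = refl
    ... | no i≢i   = contradiction refl i≢i

    update-elsewhere : (c : (k : Fin n) → X k) (i : Fin n) (b : X i) {k : Fin n} →
                       k ≢ i → (c [ i ]≔ b) k ≡ c k
    update-elsewhere c i b {k} k≢i with k ≟ᶠ i
    ... | yes refl = contradiction refl k≢i
    ... | no _     = refl

    ∀-update : (P : (k : Fin n) → X k → Set) (c : (k : Fin n) → X k)
               (i : Fin n) (b : X i) →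
               (∀ k → P k ((c [ i ]≔ b) k)) ⇔ (P i b × (∀ k → k ≢ i → P k (c k)))
    ∀-update P c i b = mk⇔
      (λ h → subst (P i) (update-at c i b) (h i) ,
             λ k k≢i → subst (P k) (update-elsewhere c i b k≢i) (h k))
      (λ (Pb , Pc) → ∀-at-and-elsewhere i
        (subst (P i) (≡.sym (update-at c i b)) Pb)
        (λ k k≢i → subst (P k) (≡.sym (update-elsewhere c i b k≢i)) (Pc k k≢i)))

    ∀-resp-≗ : (P : (k : Fin n) → X k → Set) {c d : (k : Fin n) → X k} →
               (∀ k → c k ≡ d k) → (∀ k → P k (c k)) ⇔ (∀ k → P k (d k))
    ∀-resp-≗ P c≗d = mk⇔ (λ h k → subst (P k) (c≗d k) (h k))
                          (λ h k → subst (P k) (≡.sym (c≗d k)) (h k))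

NK-mono : (G : Graph) (W : V G → Set) {a b : V G} →
          (N[ G ]∋ a) ⊆ (N[ G ]∋ b) → NK G W a ⊆ NK G W b
NK-mono G W Na⊆Nb w (Ww , aw) = Ww , Na⊆Nb w aw

induced : (A : Graph) → (V A → Set) → Subgraph A
induced A S = record
  { U     = S
  ; E     = λ a b → S a × S b × Adj A a b
  ; E⊆Adj = λ (_ , _ , ab) → ab
  ; E⊆U   = λ (Sa , Sb , _) → Sa , Sb
  ; Esym  = λ (Sa , Sb , ab) → Sb , Sa , Graph.sym A ab
  }

module Coordinates {G : Graph} {n : ℕ} {F : Fin n → Graph} (ι : IsoStrong G F) where
  open IsoStrong ι

  N-coords : (u w : V G) → (N[ G ]∋ u) w ⇔ (∀ k → (N[ F k ]∋ φ u k) (φ w k))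
  N-coords u w = mk⇔ coords vertex
    where
      coords : (N[ G ]∋ u) w → ∀ k → (N[ F k ]∋ φ u k) (φ w k)
      coords (inj₁ refl) k = inj₁ refl
      coords (inj₂ uw)   k = [ (λ e → inj₁ (≡.sym e)) , inj₂ ] (proj₂ (to (adj u w) uw) k)

      vertex : (∀ k → (N[ F k ]∋ φ u k) (φ w k)) → (N[ G ]∋ u) w
      vertex h with all? (λ k → vertex-≟ (F k) (φ w k) (φ u k))
      ... | yes w≗u = inj₁ (inj w u w≗u)
      ... | no  w≉u = inj₂ (from (adj u w)
                        ((λ u≗w → w≉u (λ k → ≡.sym (u≗w k))) ,
                         λ k → [ (λ e → inj₁ (≡.sym e)) , inj₂ ] (h k)))

  vertexAt : ((k : Fin n) → V (F k)) → V G
  vertexAt c = proj₁ (surj c)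

  φ-vertexAt : (c : (k : Fin n) → V (F k)) (k : Fin n) → φ (vertexAt c) k ≡ c k
  φ-vertexAt c = proj₂ (surj c)

  _[_≔_] : V G → (i : Fin n) → V (F i) → V G
  v [ i ≔ b ] = vertexAt (φ v [ i ]≔ b)

  φ-set-at : (v : V G) (i : Fin n) (b : V (F i)) → φ (v [ i ≔ b ]) i ≡ b
  φ-set-at v i b = ≡.trans (φ-vertexAt _ i) (update-at (φ v) i b)

  φ-set-elsewhere : (v : V G) (i : Fin n) (b : V (F i)) {k : Fin n} →
                    k ≢ i → φ (v [ i ≔ b ]) k ≡ φ v k
  φ-set-elsewhere v i b k≢i = ≡.trans (φ-vertexAt _ _) (update-elsewhere (φ v) i b k≢i)

  N-set-centre : (v w : V G) (i : Fin n) (b : V (F i)) →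
                 (N[ G ]∋ (v [ i ≔ b ])) w ⇔
                 ((N[ F i ]∋ b) (φ w i) × (∀ k → k ≢ i → (N[ F k ]∋ φ v k) (φ w k)))
  N-set-centre v w i b =
    ∀-update P (φ v) i b ⇔-∘ (∀-resp-≗ P (φ-vertexAt _) ⇔-∘ N-coords (v [ i ≔ b ]) w)
    where
      P : (k : Fin n) → V (F k) → Set
      P k a = (N[ F k ]∋ a) (φ w k)

  N-set-member : (u v : V G) (i : Fin n) (b : V (F i)) → (N[ G ]∋ u) v →
                 (N[ G ]∋ u) (v [ i ≔ b ]) ⇔ (N[ F i ]∋ φ u i) b
  N-set-member u v i b uv =
    mk⇔ (λ h → proj₁ (to coords h)) (λ ub → from coords (ub , λ k _ → to (N-coords u v) uv k))
    where
      coords : (N[ G ]∋ u) (v [ i ≔ b ]) ⇔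
               ((N[ F i ]∋ φ u i) b × (∀ k → k ≢ i → (N[ F k ]∋ φ u k) (φ v k)))
      coords = ∀-update (λ k → N[ F k ]∋ φ u k) (φ v) i b
                 ⇔-∘ (∀-resp-≗ (λ k → N[ F k ]∋ φ u k) (φ-vertexAt _)
                 ⇔-∘ N-coords u (v [ i ≔ b ]))

  DifferAtMostOnce : V G → V G → Set
  DifferAtMostOnce u v = ∀ {i j} → φ u i ≢ φ v i → j ≢ i → φ u j ≡ φ v j

  cartesian-if-differ-at-most-once : {u v : V G} → u ≢ v → DifferAtMostOnce u v →
                                     Cartesian ι u v
  cartesian-if-differ-at-most-once {u} {v} u≢v once =
    let (i , uᵢ≢vᵢ) = ¬∀⟶∃¬ n _ (λ k → vertex-≟ (F k) (φ u k) (φ v k))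
                                (λ u≗v → u≢v (inj u v u≗v))
    in i , uᵢ≢vᵢ , λ j j≢i → once uᵢ≢vᵢ j≢i

  EN-box : {u v : V G} → Cartesian ι u v → (w : V G) →
           EN G u v w ⇔ (∀ k → ((N[ F k ]∋ φ u k) ∪ (N[ F k ]∋ φ v k)) (φ w k))
  EN-box {u} {v} (i , _ , agree) w = mk⇔ to-box from-box
    where
      to-box : EN G u v w → ∀ k → ((N[ F k ]∋ φ u k) ∪ (N[ F k ]∋ φ v k)) (φ w k)
      to-box (inj₁ uw) k = inj₁ (to (N-coords u w) uw k)
      to-box (inj₂ vw) k = inj₂ (to (N-coords v w) vw k)

      N[_]ₖ : (k : Fin n) → V (F k) → Set
      N[ k ]ₖ c = (N[ F k ]∋ c) (φ w k)

      from-box : (∀ k → ((N[ F k ]∋ φ u k) ∪ (N[ F k ]∋ φ v k)) (φ w k)) → EN G u v w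
      from-box h with h i
      ... | inj₁ uwᵢ = inj₁ (from (N-coords u w) (∀-at-and-elsewhere i uwᵢ λ k k≢i →
              [ id , subst N[ k ]ₖ (≡.sym (agree k k≢i)) ] (h k)))
      ... | inj₂ vwᵢ = inj₂ (from (N-coords v w) (∀-at-and-elsewhere i vwᵢ λ k k≢i →
              [ subst N[ k ]ₖ (agree k k≢i) , id ] (h k)))

  box-isSubproduct : (W : V G → Set) (S : (k : Fin n) → V (F k) → Set) →
                     (∀ w → W w ⇔ (∀ k → S k (φ w k))) → IsSubproduct ι W
  box-isSubproduct W S W⇔box = (λ k → induced (F k) (S k)) , W⇔box , λ u v Wu Wv → mk⇔
    (λ uv → let (u≉v , steps) = to (adj u v) uv in
      u≉v , λ k → map₂ (λ a → to (W⇔box u) Wu k , to (W⇔box v) Wv k , a) (steps k))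
    (λ (u≉v , steps) → from (adj u v) (u≉v , λ k → map₂ (λ (_ , _ , a) → a) (steps k)))

  EN-isSubproduct : {u v : V G} → Cartesian ι u v → IsSubproduct ι (EN G u v)
  EN-isSubproduct {u} {v} uv =
    box-isSubproduct (EN G u v) (λ k → (N[ F k ]∋ φ u k) ∪ (N[ F k ]∋ φ v k)) (EN-box uv)

module IndispensableEdge {G : Graph} (thin : Thin G) {n : ℕ} {F : Fin n → Graph}
                         (ι : IsoStrong G F) {x y : V G} (xy : Adj G x y) where
  open IsoStrong ι
  open Coordinates ι

  𝒜 ℬ : (k : Fin n) → V (F k) → Set
  𝒜 k = N[ F k ]∋ φ x k
  ℬ k = N[ F k ]∋ φ y k

  x∈N[y] : (N[ G ]∋ y) x
  x∈N[y] = inj₂ (Graph.sym G xy)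

  x∈𝒜 : ∀ k → 𝒜 k (φ x k)
  x∈𝒜 k = inj₁ refl

  x∈ℬ : ∀ k → ℬ k (φ x k)
  x∈ℬ = to (N-coords y x) x∈N[y]

  z : Fin n → V G
  z i = x [ i ≔ φ y i ]

  N[z] : (i : Fin n) (w : V G) →
         (N[ G ]∋ z i) w ⇔ (ℬ i (φ w i) × (∀ k → k ≢ i → 𝒜 k (φ w k)))
  N[z] i w = N-set-centre x w i (φ y i)

  x∈N[z] : (i : Fin n) → (N[ G ]∋ z i) x
  x∈N[z] i = from (N[z] i x) (x∈ℬ i , λ k _ → x∈𝒜 k)

  set-∈N[x] : ∀ {k} {c : V (F k)} → (N[ G ]∋ x) (x [ k ≔ c ]) ⇔ 𝒜 k c
  set-∈N[x] = N-set-member x x _ _ (inj₁ refl)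

  set-∈N[y] : ∀ {k} {c : V (F k)} → (N[ G ]∋ y) (x [ k ≔ c ]) ⇔ ℬ k c
  set-∈N[y] = N-set-member y x _ _ x∈N[y]

  set-∈N[z]-at : ∀ {i} {c : V (F i)} → (N[ G ]∋ z i) (x [ i ≔ c ]) ⇔ ℬ i c
  set-∈N[z]-at {i} {c} =
    subst (λ a → (N[ G ]∋ z i) (x [ i ≔ c ]) ⇔ (N[ F i ]∋ a) c)
    (φ-set-at x i (φ y i)) (N-set-member (z i) x i c (x∈N[z] i))

  set-∈N[z]-elsewhere : ∀ {i k} {c : V (F k)} → k ≢ i →
                        (N[ G ]∋ z i) (x [ k ≔ c ]) ⇔ 𝒜 k c
  set-∈N[z]-elsewhere {i} {k} {c} k≢i =
    subst (λ a → (N[ G ]∋ z i) (x [ k ≔ c ]) ⇔ (N[ F k ]∋ a) c)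
    (φ-set-elsewhere x i (φ y i) k≢i) (N-set-member (z i) x k c (x∈N[z] i))

  N[x]⊆N[z] : ∀ {i} → 𝒜 i ⊆ ℬ i → (N[ G ]∋ x) ⊆ (N[ G ]∋ z i)
  N[x]⊆N[z] {i} 𝒜⊆ℬ w xw =
    let coords = to (N-coords x w) xw in
    from (N[z] i w) (𝒜⊆ℬ _ (coords i) , λ k _ → coords k)

  N[y]⊆N[z] : ∀ {i} → (∀ k → k ≢ i → ℬ k ⊆ 𝒜 k) → (N[ G ]∋ y) ⊆ (N[ G ]∋ z i)
  N[y]⊆N[z] {i} ℬ⊆𝒜 w yw =
    let coords = to (N-coords y w) yw in
    from (N[z] i w) (coords i , λ k k≢i → ℬ⊆𝒜 k k≢i _ (coords k))

  N[z]⊆N[x] : ∀ {i} → ℬ i ⊆ 𝒜 i → (N[ G ]∋ z i) ⊆ (N[ G ]∋ x)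
  N[z]⊆N[x] {i} ℬ⊆𝒜 w zw =
    let (wᵢ∈ℬ , wₖ∈𝒜) = to (N[z] i w) zw in
    from (N-coords x w) (∀-at-and-elsewhere i (ℬ⊆𝒜 _ wᵢ∈ℬ) wₖ∈𝒜)

  N[z]⊆N[y] : ∀ {i} → (∀ k → k ≢ i → 𝒜 k ⊆ ℬ k) → (N[ G ]∋ z i) ⊆ (N[ G ]∋ y)
  N[z]⊆N[y] {i} 𝒜⊆ℬ w zw =
    let (wᵢ∈ℬ , wₖ∈𝒜) = to (N[z] i w) zw in
    from (N-coords y w) (∀-at-and-elsewhere i wᵢ∈ℬ λ k k≢i → 𝒜⊆ℬ k k≢i _ (wₖ∈𝒜 k k≢i))

  coordinate-≡ : ∀ k → 𝒜 k ⊆ ℬ k → ℬ k ⊆ 𝒜 k → φ x k ≡ φ y k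
  coordinate-≡ k 𝒜⊆ℬ ℬ⊆𝒜 = ≡.trans (≡.cong (λ u → φ u k) x≡zₖ) (φ-set-at x k (φ y k))
    where
      x≡zₖ : x ≡ z k
      x≡zₖ = thin x (z k) λ w → mk⇔ (N[x]⊆N[z] 𝒜⊆ℬ w) (N[z]⊆N[x] ℬ⊆𝒜 w)

  W : V G → Set
  W = EN G x y

  Nx Ny : V G → Set
  Nx = NK G W x
  Ny = NK G W y

  Nz : Fin n → V G → Set
  Nz i = NK G W (z i)

  z∈W : ∀ i → W (z i)
  z∈W i = inj₁ (N-sym G (x∈N[z] i))

  Nx∩Ny⊆Nz : ∀ {i} → (Nx ∩ Ny) ⊆ Nz i
  Nx∩Ny⊆Nz {i} w ((Ww , xw) , (_ , yw)) =
    Ww , from (N[z] i w) (to (N-coords y w) yw i , λ k _ → to (N-coords x w) xw k)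

  Nx∩Nz⊈Ny : ∀ {i j} → j ≢ i → 𝒜 j ⊈ ℬ j → (Nx ∩ Nz i) ⊈ Ny
  Nx∩Nz⊈Ny j≢i (c , 𝒜c , ¬ℬc) =
    let xc = from set-∈N[x] 𝒜c in
    x [ _ ≔ c ] , ((inj₁ xc , xc) , (inj₁ xc , from (set-∈N[z]-elsewhere j≢i) 𝒜c)) ,
    λ (_ , yc) → ¬ℬc (to set-∈N[y] yc)

  Ny∩Nz⊈Nx : ∀ {i} → ℬ i ⊈ 𝒜 i → (Ny ∩ Nz i) ⊈ Nx
  Ny∩Nz⊈Nx (c , ℬc , ¬𝒜c) =
    let yc = from set-∈N[y] ℬc in
    x [ _ ≔ c ] , ((inj₂ yc , yc) , (inj₂ yc , from set-∈N[z]-at ℬc)) ,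
    λ (_ , xc) → ¬𝒜c (to set-∈N[x] xc)

  Nx⊈Nz : ∀ {i} → 𝒜 i ⊈ ℬ i → Nx ⊈ Nz i
  Nx⊈Nz (c , 𝒜c , ¬ℬc) =
    let xc = from set-∈N[x] 𝒜c in
    x [ _ ≔ c ] , (inj₁ xc , xc) , λ (_ , zc) → ¬ℬc (to set-∈N[z]-at zc)

  Ny⊈Nz : ∀ {i j} → j ≢ i → ℬ j ⊈ 𝒜 j → Ny ⊈ Nz i
  Ny⊈Nz j≢i (c , ℬc , ¬𝒜c) =
    let yc = from set-∈N[y] ℬc in
    x [ _ ≔ c ] , (inj₂ yc , yc) , λ (_ , zc) → ¬𝒜c (to (set-∈N[z]-elsewhere j≢i) zc)

  -- shared-* and nested-* give the first and second alternatives of conditions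
  -- (1) and (2) of dispensability, with z i as the witness.
  shared-x : ∀ {i j} → j ≢ i → 𝒜 j ⊈ ℬ j → (Nx ∩ Ny) ⊂ (Nx ∩ Nz i)
  shared-x j≢i 𝒜ⱼ⊈ℬⱼ =
    (λ w h → proj₁ h , Nx∩Ny⊆Nz w h) , ⊈-weaken (Nx∩Nz⊈Ny j≢i 𝒜ⱼ⊈ℬⱼ) (λ _ → id) (λ _ → proj₂)

  shared-y : ∀ {i} → ℬ i ⊈ 𝒜 i → (Nx ∩ Ny) ⊂ (Ny ∩ Nz i)
  shared-y ℬᵢ⊈𝒜ᵢ =
    (λ w h → proj₂ h , Nx∩Ny⊆Nz w h) , ⊈-weaken (Ny∩Nz⊈Nx ℬᵢ⊈𝒜ᵢ) (λ _ → id) (λ _ → proj₁)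

  nested-x : ∀ {i j} → (∀ k → 𝒜 k ⊆ ℬ k) → ℬ i ⊈ 𝒜 i → j ≢ i → ℬ j ⊈ 𝒜 j →
             Nx ⊂ Nz i × Nz i ⊂ Ny
  nested-x 𝒜⊆ℬ ℬᵢ⊈𝒜ᵢ j≢i ℬⱼ⊈𝒜ⱼ =
    (NK-mono G W (N[x]⊆N[z] (𝒜⊆ℬ _)) ,
     ⊈-weaken (Ny∩Nz⊈Nx ℬᵢ⊈𝒜ᵢ) (λ _ → proj₂) (λ _ → id)) ,
    (NK-mono G W (N[z]⊆N[y] λ k _ → 𝒜⊆ℬ k) , Ny⊈Nz j≢i ℬⱼ⊈𝒜ⱼ)

  nested-y : ∀ {i j} → (∀ k → ℬ k ⊆ 𝒜 k) → 𝒜 i ⊈ ℬ i → j ≢ i → 𝒜 j ⊈ ℬ j →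
             Ny ⊂ Nz i × Nz i ⊂ Nx
  nested-y ℬ⊆𝒜 𝒜ᵢ⊈ℬᵢ j≢i 𝒜ⱼ⊈ℬⱼ =
    (NK-mono G W (N[y]⊆N[z] λ k _ → ℬ⊆𝒜 k) ,
     ⊈-weaken (Nx∩Nz⊈Ny j≢i 𝒜ⱼ⊈ℬⱼ) (λ _ → proj₂) (λ _ → id)) ,
    (NK-mono G W (N[z]⊆N[x] (ℬ⊆𝒜 _)) , Nx⊈Nz 𝒜ᵢ⊈ℬᵢ)

  module _ (indispensable : Indispensable G W x y) where

    no-crossed-differences : ∀ {i j} → j ≢ i → ℬ i ⊈ 𝒜 i → ¬ 𝒜 j ⊈ ℬ j
    no-crossed-differences j≢i ℬᵢ⊈𝒜ᵢ 𝒜ⱼ⊈ℬⱼ =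
      indispensable (_ , z∈W _ , inj₁ (shared-x j≢i 𝒜ⱼ⊈ℬⱼ) , inj₁ (shared-y ℬᵢ⊈𝒜ᵢ))

    no-two-ℬ⊈𝒜 : ∀ {i j} → j ≢ i → ℬ i ⊈ 𝒜 i → ¬ ℬ j ⊈ 𝒜 j
    no-two-ℬ⊈𝒜 {i} {j} j≢i ℬᵢ⊈𝒜ᵢ ℬⱼ⊈𝒜ⱼ =
      indispensable (z i , z∈W i , inj₂ (nested-x 𝒜⊆ℬ ℬᵢ⊈𝒜ᵢ j≢i ℬⱼ⊈𝒜ⱼ) ,
                     inj₁ (shared-y ℬᵢ⊈𝒜ᵢ))
      where
        𝒜⊆ℬ : ∀ k → 𝒜 k ⊆ ℬ k
        𝒜⊆ℬ k = ⊆-from-¬⊈ (N-dec (F k) _) (∀-at-and-elsewhere i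
          (no-crossed-differences (≡.≢-sym j≢i) ℬⱼ⊈𝒜ⱼ)
          (λ k k≢i → no-crossed-differences k≢i ℬᵢ⊈𝒜ᵢ) k)

    no-two-𝒜⊈ℬ : ∀ {i j} → j ≢ i → ¬ ℬ i ⊈ 𝒜 i → 𝒜 i ⊈ ℬ i → ¬ 𝒜 j ⊈ ℬ j
    no-two-𝒜⊈ℬ {i} {j} j≢i ¬ℬᵢ⊈𝒜ᵢ 𝒜ᵢ⊈ℬᵢ 𝒜ⱼ⊈ℬⱼ =
      indispensable (z i , z∈W i , inj₁ (shared-x j≢i 𝒜ⱼ⊈ℬⱼ) ,
                     inj₂ (nested-y ℬ⊆𝒜 𝒜ᵢ⊈ℬᵢ j≢i 𝒜ⱼ⊈ℬⱼ))
      where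
        ℬ⊆𝒜 : ∀ k → ℬ k ⊆ 𝒜 k
        ℬ⊆𝒜 k = ⊆-from-¬⊈ (N-dec (F k) _) (∀-at-and-elsewhere i ¬ℬᵢ⊈𝒜ᵢ
          (λ k k≢i ℬₖ⊈𝒜ₖ → no-crossed-differences (≡.≢-sym k≢i) ℬₖ⊈𝒜ₖ 𝒜ᵢ⊈ℬᵢ) k)

    differs : ∀ {k} → φ x k ≢ φ y k → ¬ 𝒜 k ⊈ ℬ k → ¬ ¬ ℬ k ⊈ 𝒜 k
    differs {k} xₖ≢yₖ ¬𝒜ₖ⊈ℬₖ ¬ℬₖ⊈𝒜ₖ = xₖ≢yₖ (coordinate-≡ k
      (⊆-from-¬⊈ (N-dec (F k) _) ¬𝒜ₖ⊈ℬₖ) (⊆-from-¬⊈ (N-dec (F k) _) ¬ℬₖ⊈𝒜ₖ))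

    no-two-differences : ∀ {i j} → j ≢ i → φ x i ≢ φ y i → ¬ φ x j ≢ φ y j
    no-two-differences {i} {j} j≢i xᵢ≢yᵢ xⱼ≢yⱼ = ¬¬-excluded-middle λ where
      (yes ℬᵢ⊈𝒜ᵢ) → differs xⱼ≢yⱼ (no-crossed-differences j≢i ℬᵢ⊈𝒜ᵢ) (no-two-ℬ⊈𝒜 j≢i ℬᵢ⊈𝒜ᵢ)
      (no ¬ℬᵢ⊈𝒜ᵢ) → ¬¬-excluded-middle λ where
        (no ¬𝒜ᵢ⊈ℬᵢ) → differs xᵢ≢yᵢ ¬𝒜ᵢ⊈ℬᵢ ¬ℬᵢ⊈𝒜ᵢ
        (yes 𝒜ᵢ⊈ℬᵢ) → differs xⱼ≢yⱼ (no-two-𝒜⊈ℬ j≢i ¬ℬᵢ⊈𝒜ᵢ 𝒜ᵢ⊈ℬᵢ)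
                        (λ ℬⱼ⊈𝒜ⱼ → no-crossed-differences (≡.≢-sym j≢i) ℬⱼ⊈𝒜ⱼ 𝒜ᵢ⊈ℬᵢ)

    differ-at-most-once : DifferAtMostOnce x y
    differ-at-most-once xᵢ≢yᵢ j≢i =
      decidable-stable (vertex-≟ (F _) _ _) (no-two-differences j≢i xᵢ≢yᵢ)

corollary3p9 : (G : Graph) → Connected G → Thin G → (D : PFD G) →
    (x y : V G) → Adj G x y → Indispensable G (EN G x y) x y →
    Cartesian (PFD.iso D) x y × IsSubproduct (PFD.iso D) (EN G x y)
corollary3p9 G _ thin D x y xy indispensable = cartesian , EN-isSubproduct cartesian
  where
    open PFD D using (iso)
    open Coordinates iso using (cartesian-if-differ-at-most-once; EN-isSubproduct)
    open IndispensableEdge thin iso xy using (differ-at-most-once)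

    cartesian : Cartesian iso x y
    cartesian = cartesian-if-differ-at-most-once (λ { refl → Graph.irrefl G xy })
                  (differ-at-most-once indispensable)
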